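{- Let $(G,+)$ be a group (not necessarily commutative), let $I[1],\dots,I[N]$ ($N\ge 1$) be elements of $G$, and let $A$ be the array obtained from $I$ by the Southwest Tree build procedure described in the context. Then for every $1\le i\le N$, the procedure $\texttt{accumulate}(i)$ described in the context returns $$I[1]+I[2]+\cdots+I[i],$$ with operands combined in increasing order of index.
   Context: Southwest Tree index structure: let $h_r=\lfloor \log_2 N\rfloor+1$. Define a full binary tree whose nodes are labelled by indices as follows: the root has index $2^{h_r}-1$ and height $h_r$; a node with index $i$ and height $h>1$ has left child with index $i-2^{h-1}$ and right child with index $i-1$, both of height $h-1$; nodes of height $1$ are leaves. Every index in $\{1,\dots,2^{h_r}-1\}$ occurs as exactly one node. Indices greater than $N$ are "phantom" nodes storing no value. Build procedure: initially $A[j]=I[j]$ for $1\le j\le N$. The tree is traversed depth-first in post-order; when visiting a node of index $i\le N$ with height $h>1$, set $A[i] := A[i-2^{h-1}] + A[i-1] + A[i]$ (in this order); phantom nodes and leaves are unchanged. Accumulate procedure: $\texttt{accumulate}(i)=\mathrm{acc}(i,\,2^{h_r}-1,\,2^{h_r-1})$, where $\mathrm{acc}(i,c,\ell)$ is defined recursively: if $c=i$, return $A[c]$; otherwise let $c'=c-\ell$ if $i\le c-\ell$ and $c'=c-1$ otherwise, let $v=\mathrm{acc}(i,c',\ell/2)$, and return $A[c-\ell]+v$ if $i>c-\ell$, and $v$ otherwise. The operation $+$ may be non-commutative; all sums are taken in the stated order. -}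

module Defs where

open import Level using (Level)
open import Algebra.Bundles using (Group)
open import Data.Nat using (ℕ; zero; suc; _∸_; _^_; _≤?_; _≟_)
open import Data.Nat.Logarithm using (⌊log₂_⌋)
open import Data.Bool using (if_then_else_)
open import Relation.Nullary using (does)

module SouthwestTree {c ℓ : Level} (G : Group c ℓ) (N : ℕ) where
  open Group G

  -- Arrays are indexed by ℕ; only positions 1..N are meaningful.
  Arr : Set c
  Arr = ℕ → Carrier

  -- Root height h_r = ⌊log₂ N⌋ + 1 ; we write heights as suc k.
  hr : ℕ
  hr = suc ⌊log₂ N ⌋

  root : ℕ
  root = 2 ^ hr ∸ 1

  -- Update of the node i (height ≥ 2, with ℓ = 2^{h-1}), only if i ≤ N.
  visit : ℕ → ℕ → Arr → Arr
  visit ℓ i A j =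
    if does (i ≤? N)
    then (if does (j ≟ i) then (A (i ∸ ℓ) ∙ A (i ∸ 1)) ∙ A i else A j)
    else A j

  -- Post-order traversal of the subtree rooted at index i of height suc k.
  buildT : ℕ → ℕ → Arr → Arr
  buildT zero i A = A
  buildT (suc k) i A =
    visit (2 ^ suc k) i (buildT k (i ∸ 1) (buildT k (i ∸ 2 ^ suc k) A))

  build : Arr → Arr
  build I = buildT ⌊log₂ N ⌋ root I

  -- acc(i, c, ℓ) with ℓ = 2^k, node c of height suc k.
  -- The leaf case with c ≢ i never arises for 1 ≤ i ≤ N; we return ε there.
  acc : Arr → ℕ → ℕ → ℕ → Carrier
  acc A i zero c = if does (c ≟ i) then A c else ε
  acc A i (suc k) c =
    if does (c ≟ i) then A c
    else (if does (i ≤? c ∸ 2 ^ suc k)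
          then acc A i k (c ∸ 2 ^ suc k)
          else A (c ∸ 2 ^ suc k) ∙ acc A i k (c ∸ 1))

  accumulate : Arr → ℕ → Carrier
  accumulate A i = acc A i ⌊log₂ N ⌋ root

  prefix : Arr → ℕ → Carrier
  prefix I zero = ε
  prefix I (suc zero) = I 1
  prefix I (suc (suc n)) = prefix I (suc n) ∙ I (suc (suc n))

{-# OPTIONS --safe #-}
-- In post-order, a subtree of height h occupies 2^h − 1 consecutive indices and
-- is rooted at the last of them, its two subtrees filling the two halves of the
-- rest.  Building a subtree therefore changes nothing outside its index range and
-- leaves in its root (if that root is ≤ N) the sum of the inputs over the range.
-- accumulate(i) walks from the root down to i, and each time it turns right it
-- adds the root of the left subtree it passes, i.e. the sum of the block just
-- before; these blocks tile 1, …, i from left to right, so only associativity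
-- and the unit law are needed.

module Submission where

open import Defs
open import Level using (Level; _⊔_)
open import Algebra.Bundles using (Monoid; Group)
open import Data.Nat using (ℕ; zero; suc; _+_; _∸_; _^_; _≤_; _<_; _≤?_; _≟_; z≤n; s≤s⁻¹)
open import Data.Nat.Properties
open import Data.Nat.Logarithm using (⌊log₂_⌋; ⌊log₂⌋-mono-≤; ⌊log₂[2^n]⌋≡n)
open import Data.Nat.Tactic.RingSolver using (solve-∀)
open import Data.Bool.Base using (true; false; if_then_else_)
open import Data.Product.Base using (_,_)
open import Relation.Nullary using (does; yes; no)
open import Relation.Nullary.Decidable using (dec-true; dec-false)
open import Relation.Binary.PropositionalEquality
  using (_≡_; _≢_; refl; sym; trans; cong; cong₂; subst; module ≡-Reasoning)
import Relation.Binary.Reasoning.Setoid as SetoidReasoning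

n<2^[1+⌊log₂n⌋] : ∀ n → n < 2 ^ suc ⌊log₂ n ⌋
n<2^[1+⌊log₂n⌋] n = ≰⇒> λ 2^[1+⌊log₂n⌋]≤n →
  1+n≰n (subst (_≤ ⌊log₂ n ⌋) (⌊log₂[2^n]⌋≡n (suc ⌊log₂ n ⌋)) (⌊log₂⌋-mono-≤ 2^[1+⌊log₂n⌋]≤n))

-- The subtree of height suc k whose first index is lo occupies lo, …, lo + span k.
span : ℕ → ℕ
span zero    = 0
span (suc k) = suc (span k) + suc (span k)

2^[1+k]≡2+span : ∀ k → 2 ^ suc k ≡ 2 + span k
2^[1+k]≡2+span zero    = refl
2^[1+k]≡2+span (suc k) =
  trans (cong (λ x → x + (x + 0)) (2^[1+k]≡2+span k)) (double (span k))
  where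
  double : ∀ s → 2 + s + (2 + s + 0) ≡ 2 + (suc s + suc s)
  double = solve-∀

module Node (k lo : ℕ) where

  leftRoot rightStart rightRoot root : ℕ
  leftRoot   = lo + span k
  rightStart = lo + suc (span k)
  rightRoot  = rightStart + span k
  root       = lo + span (suc k)

  root≡1+rightRoot : root ≡ suc rightRoot
  root≡1+rightRoot = layout lo (span k)
    where
    layout : ∀ lo s → lo + (suc s + suc s) ≡ suc (lo + suc s + s)
    layout = solve-∀

  root∸1≡rightRoot : root ∸ 1 ≡ rightRoot
  root∸1≡rightRoot = cong (_∸ 1) root≡1+rightRoot

  root∸2^[1+k]≡leftRoot : root ∸ 2 ^ suc k ≡ leftRoot
  root∸2^[1+k]≡leftRoot = begin
    root ∸ 2 ^ suc k                       ≡⟨ cong₂ _∸_ (layout lo (span k)) (2^[1+k]≡2+span k) ⟩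
    leftRoot + (2 + span k) ∸ (2 + span k) ≡⟨ m+n∸n≡m leftRoot (2 + span k) ⟩
    leftRoot                               ∎
    where
    open ≡-Reasoning
    layout : ∀ lo s → lo + (suc s + suc s) ≡ lo + s + (2 + s)
    layout = solve-∀

  lo≤leftRoot : lo ≤ leftRoot
  lo≤leftRoot = m≤m+n lo (span k)

  leftRoot<rightStart : leftRoot < rightStart
  leftRoot<rightStart = +-monoʳ-< lo (n<1+n (span k))

  rightStart≤rightRoot : rightStart ≤ rightRoot
  rightStart≤rightRoot = m≤m+n rightStart (span k)

  rightRoot<root : rightRoot < root
  rightRoot<root = ≤-reflexive (sym root≡1+rightRoot)

  leftRoot<root : leftRoot < root
  leftRoot<root = <-trans leftRoot<rightStart (≤-<-trans rightStart≤rightRoot rightRoot<root)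

  lo≤rightStart : lo ≤ rightStart
  lo≤rightStart = ≤-trans lo≤leftRoot (<⇒≤ leftRoot<rightStart)

  lo≤root : lo ≤ root
  lo≤root = ≤-trans lo≤leftRoot (<⇒≤ leftRoot<root)

data Offset (k : ℕ) : ℕ → Set where
  inLeft  : ∀ {n} → n ≤ span k → Offset k n
  inRight : ∀ {m} → m ≤ span k → Offset k (suc (span k) + m)
  atRoot  : Offset k (span (suc k))

offset : ∀ k n → n ≤ span (suc k) → Offset k n
offset k n n≤span[1+k] with n ≤? span k
... | yes n≤span = inLeft n≤span
... | no n≰span with (m , refl) ← m≤n⇒∃[o]m+o≡n (≰⇒> n≰span) with m ≟ suc (span k)
...   | yes refl = atRoot
...   | no m≢1+span = inRight (s≤s⁻¹ (≤∧≢⇒< (+-cancelˡ-≤ (suc (span k)) m _ n≤span[1+k]) m≢1+span))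

module RangeSum {c ℓ : Level} (M : Monoid c ℓ) where
  open Monoid M hiding (refl; sym; trans)

  sumFrom : (ℕ → Carrier) → ℕ → ℕ → Carrier
  sumFrom A lo zero    = ε
  sumFrom A lo (suc n) = sumFrom A lo n ∙ A (lo + n)

  sumFrom-+ : ∀ A lo m n → sumFrom A lo (m + n) ≈ sumFrom A lo m ∙ sumFrom A (lo + m) n
  sumFrom-+ A lo m zero = begin
    sumFrom A lo (m + 0)   ≡⟨ cong (sumFrom A lo) (+-identityʳ m) ⟩
    sumFrom A lo m         ≈⟨ identityʳ _ ⟨
    sumFrom A lo m ∙ ε     ∎
    where open SetoidReasoning setoid
  sumFrom-+ A lo m (suc n) = begin
    sumFrom A lo (m + suc n)                                 ≡⟨ cong (sumFrom A lo) (+-suc m n) ⟩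
    sumFrom A lo (m + n) ∙ A (lo + (m + n))                  ≈⟨ ∙-cong (sumFrom-+ A lo m n) (reflexive (cong A (sym (+-assoc lo m n)))) ⟩
    (sumFrom A lo m ∙ sumFrom A (lo + m) n) ∙ A (lo + m + n) ≈⟨ assoc _ _ _ ⟩
    sumFrom A lo m ∙ sumFrom A (lo + m) (suc n)              ∎
    where open SetoidReasoning setoid

  sumFrom-cong : ∀ {A B} lo n → (∀ j → j < n → A (lo + j) ≡ B (lo + j)) → sumFrom A lo n ≡ sumFrom B lo n
  sumFrom-cong lo zero    A≡B = refl
  sumFrom-cong lo (suc n) A≡B =
    cong₂ _∙_ (sumFrom-cong lo n λ j j<n → A≡B j (m<n⇒m<1+n j<n)) (A≡B n (n<1+n n))

module SouthwestTreeProperties {c ℓ : Level} (G : Group c ℓ) (N : ℕ) where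
  open Group G hiding (refl) renaming (sym to ≈-sym; trans to ≈-trans)
  open SouthwestTree G N hiding (root)
  open RangeSum monoid

  prefix≈sumFrom : ∀ I n → prefix I (suc n) ≈ sumFrom I 1 (suc n)
  prefix≈sumFrom I zero    = ≈-sym (identityˡ (I 1))
  prefix≈sumFrom I (suc n) = ∙-congʳ (prefix≈sumFrom I n)

  EqualOn : ℕ → ℕ → Arr → Arr → Set c
  EqualOn a b B B′ = ∀ j → a ≤ j → j ≤ b → B j ≡ B′ j

  EqualOn-mono : ∀ {a a′ b b′ B B′} → a ≤ a′ → b′ ≤ b → EqualOn a b B B′ → EqualOn a′ b′ B B′
  EqualOn-mono a≤a′ b′≤b B≡B′ j a′≤j j≤b′ = B≡B′ j (≤-trans a≤a′ a′≤j) (≤-trans j≤b′ b′≤b)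

  visit-other : ∀ l i Y j → j ≢ i → visit l i Y j ≡ Y j
  visit-other l i Y j j≢i with does (i ≤? N)
  ... | false = refl
  ... | true rewrite dec-false (j ≟ i) j≢i = refl

  visit-self : ∀ l i Y → i ≤ N → visit l i Y i ≡ (Y (i ∸ l) ∙ Y (i ∸ 1)) ∙ Y i
  visit-self l i Y i≤N rewrite dec-true (i ≤? N) i≤N | dec-true (i ≟ i) refl = refl

  acc-self : ∀ B k i → acc B i k i ≡ B i
  acc-self B zero    i rewrite dec-true (i ≟ i) refl = refl
  acc-self B (suc k) i rewrite dec-true (i ≟ i) refl = refl

  module _ (k lo : ℕ) where
    open Node k lo

    buildChildren : Arr → Arr
    buildChildren A = buildT k rightRoot (buildT k leftRoot A)

    buildT-node : ∀ A → buildT (suc k) root A ≡ visit (2 ^ suc k) root (buildChildren A)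
    buildT-node A = cong₂ (λ cₗ cᵣ → visit (2 ^ suc k) root (buildT k cᵣ (buildT k cₗ A)))
      root∸2^[1+k]≡leftRoot root∸1≡rightRoot

    buildT-node-other : ∀ A j → j ≢ root → buildT (suc k) root A j ≡ buildChildren A j
    buildT-node-other A j j≢root =
      trans (cong (λ B → B j) (buildT-node A)) (visit-other (2 ^ suc k) root (buildChildren A) j j≢root)

    buildT-node-root : ∀ A → root ≤ N →
      buildT (suc k) root A root ≡ (buildChildren A leftRoot ∙ buildChildren A rightRoot) ∙ buildChildren A root
    buildT-node-root A root≤N = begin
      buildT (suc k) root A root    ≡⟨ cong (λ B → B root) (buildT-node A) ⟩
      visit (2 ^ suc k) root Y root ≡⟨ visit-self (2 ^ suc k) root Y root≤N ⟩
      (Y (root ∸ 2 ^ suc k) ∙ Y (root ∸ 1)) ∙ Y root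
        ≡⟨ cong₂ (λ cₗ cᵣ → (Y cₗ ∙ Y cᵣ) ∙ Y root) root∸2^[1+k]≡leftRoot root∸1≡rightRoot ⟩
      (Y leftRoot ∙ Y rightRoot) ∙ Y root ∎
      where
      open ≡-Reasoning
      Y = buildChildren A

    acc-node : ∀ B i → acc B i (suc k) root ≡
      (if does (root ≟ i) then B root
       else if does (i ≤? leftRoot) then acc B i k leftRoot
       else B leftRoot ∙ acc B i k rightRoot)
    acc-node B i = cong₂ (λ cₗ cᵣ → if does (root ≟ i) then B root
                                    else if does (i ≤? cₗ) then acc B i k cₗ
                                    else B cₗ ∙ acc B i k cᵣ)
      root∸2^[1+k]≡leftRoot root∸1≡rightRoot

    acc-node-left : ∀ B i → i ≤ leftRoot → acc B i (suc k) root ≡ acc B i k leftRoot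
    acc-node-left B i i≤leftRoot
      rewrite acc-node B i
            | dec-false (root ≟ i) (λ root≡i → <⇒≢ (≤-<-trans i≤leftRoot leftRoot<root) (sym root≡i))
            | dec-true (i ≤? leftRoot) i≤leftRoot
            = refl

    acc-node-right : ∀ B i → i ≢ root → leftRoot < i →
      acc B i (suc k) root ≡ B leftRoot ∙ acc B i k rightRoot
    acc-node-right B i i≢root leftRoot<i
      rewrite acc-node B i
            | dec-false (root ≟ i) (λ root≡i → i≢root (sym root≡i))
            | dec-false (i ≤? leftRoot) (<⇒≱ leftRoot<i)
            = refl

  buildT-below : ∀ k lo A j → j < lo → buildT k (lo + span k) A j ≡ A j
  buildT-below zero    lo A j j<lo = refl
  buildT-below (suc k) lo A j j<lo = begin
    buildT (suc k) root A j                    ≡⟨ buildT-node-other k lo A j j≢root ⟩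
    buildT k rightRoot (buildT k leftRoot A) j ≡⟨ buildT-below k rightStart _ j j<rightStart ⟩
    buildT k leftRoot A j                      ≡⟨ buildT-below k lo A j j<lo ⟩
    A j                                        ∎
    where
    open Node k lo
    open ≡-Reasoning
    j<rightStart : j < rightStart
    j<rightStart = <-≤-trans j<lo lo≤rightStart
    j≢root : j ≢ root
    j≢root = <⇒≢ (<-≤-trans j<lo lo≤root)

  buildT-above : ∀ k lo A j → lo + span k < j → buildT k (lo + span k) A j ≡ A j
  buildT-above zero    lo A j root<j = refl
  buildT-above (suc k) lo A j root<j = begin
    buildT (suc k) root A j                    ≡⟨ buildT-node-other k lo A j (>⇒≢ root<j) ⟩
    buildT k rightRoot (buildT k leftRoot A) j ≡⟨ buildT-above k rightStart _ j (<-trans rightRoot<root root<j) ⟩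
    buildT k leftRoot A j                      ≡⟨ buildT-above k lo A j (<-trans leftRoot<root root<j) ⟩
    A j                                        ∎
    where
    open Node k lo
    open ≡-Reasoning

  module _ (k lo : ℕ) where
    open Node k lo

    buildT-node-left : ∀ A j → j ≤ leftRoot → buildT (suc k) root A j ≡ buildT k leftRoot A j
    buildT-node-left A j j≤leftRoot =
      trans (buildT-node-other k lo A j (<⇒≢ (≤-<-trans j≤leftRoot leftRoot<root)))
            (buildT-below k rightStart _ j (≤-<-trans j≤leftRoot leftRoot<rightStart))

    buildT-left-fixes-right : ∀ A j → buildT k leftRoot A (rightStart + j) ≡ A (rightStart + j)
    buildT-left-fixes-right A j =
      buildT-above k lo A _ (<-≤-trans leftRoot<rightStart (m≤m+n rightStart j))

  buildT-root-sum : ∀ k lo A → lo + span k ≤ N →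
    buildT k (lo + span k) A (lo + span k) ≈ sumFrom A lo (suc (span k))
  buildT-root-sum zero    lo A _        = ≈-sym (identityˡ _)
  buildT-root-sum (suc k) lo A root≤N = begin
    buildT (suc k) root A root
      ≡⟨ buildT-node-root k lo A root≤N ⟩
    (Y leftRoot ∙ Y rightRoot) ∙ Y root
      ≡⟨ cong₂ (λ x y → (x ∙ Y rightRoot) ∙ y)
           (buildT-below k rightStart X leftRoot leftRoot<rightStart)
           (trans (buildT-above k rightStart X root rightRoot<root) (buildT-above k lo A root leftRoot<root)) ⟩
    (X leftRoot ∙ Y rightRoot) ∙ A root
      ≈⟨ ∙-congʳ (∙-cong (buildT-root-sum k lo A (≤-trans (<⇒≤ leftRoot<root) root≤N))
                         (buildT-root-sum k rightStart X (≤-trans (<⇒≤ rightRoot<root) root≤N))) ⟩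
    (sumFrom A lo (suc s) ∙ sumFrom X rightStart (suc s)) ∙ A root
      ≡⟨ cong (λ x → (sumFrom A lo (suc s) ∙ x) ∙ A root)
           (sumFrom-cong rightStart (suc s) λ j _ → buildT-left-fixes-right k lo A j) ⟩
    (sumFrom A lo (suc s) ∙ sumFrom A rightStart (suc s)) ∙ A root
      ≈⟨ ∙-congʳ (sumFrom-+ A lo (suc s) (suc s)) ⟨
    sumFrom A lo (suc (span (suc k)))
      ∎
    where
    open Node k lo
    open SetoidReasoning setoid
    s = span k
    X = buildT k leftRoot A
    Y = buildChildren k lo A

  acc-cong : ∀ k lo {B B′} → EqualOn lo (lo + span k) B B′ →
    ∀ i → acc B i k (lo + span k) ≡ acc B′ i k (lo + span k)
  acc-cong zero lo B≡B′ i with does (lo + 0 ≟ i)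
  ... | true  = B≡B′ (lo + 0) (m≤m+n lo 0) ≤-refl
  ... | false = refl
  acc-cong (suc k) lo {B} {B′} B≡B′ i with i ≟ Node.root k lo | i ≤? Node.leftRoot k lo
  ... | yes refl | _ =
    trans (acc-self B (suc k) root) (trans (B≡B′ root lo≤root ≤-refl) (sym (acc-self B′ (suc k) root)))
    where open Node k lo
  ... | no i≢root | yes i≤leftRoot =
    trans (acc-node-left k lo B i i≤leftRoot)
      (trans (acc-cong k lo (EqualOn-mono ≤-refl (<⇒≤ leftRoot<root) B≡B′) i)
             (sym (acc-node-left k lo B′ i i≤leftRoot)))
    where open Node k lo
  ... | no i≢root | no i≰leftRoot =
    trans (acc-node-right k lo B i i≢root (≰⇒> i≰leftRoot))
      (trans (cong₂ _∙_ (B≡B′ leftRoot lo≤leftRoot (<⇒≤ leftRoot<root))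
                        (acc-cong k rightStart (EqualOn-mono lo≤rightStart (<⇒≤ rightRoot<root) B≡B′) i))
             (sym (acc-node-right k lo B′ i i≢root (≰⇒> i≰leftRoot))))
    where open Node k lo

  AccumulatesPrefixSums : ℕ → Set (c ⊔ ℓ)
  AccumulatesPrefixSums k = ∀ lo A n → n ≤ span k → lo + n ≤ N →
    acc (buildT k (lo + span k) A) (lo + n) k (lo + span k) ≈ sumFrom A lo (suc n)

  module _ (k lo : ℕ) (A : Arr) (ih : AccumulatesPrefixSums k) where
    open Node k lo
    open SetoidReasoning setoid

    private
      X Y B : Arr
      X = buildT k leftRoot A
      Y = buildChildren k lo A
      B = buildT (suc k) root A

    accumulates-inLeft : ∀ n → n ≤ span k → lo + n ≤ N → acc B (lo + n) (suc k) root ≈ sumFrom A lo (suc n)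
    accumulates-inLeft n n≤span i≤N = begin
      acc B (lo + n) (suc k) root ≡⟨ acc-node-left k lo B (lo + n) (+-monoʳ-≤ lo n≤span) ⟩
      acc B (lo + n) k leftRoot   ≡⟨ acc-cong k lo (λ j _ → buildT-node-left k lo A j) (lo + n) ⟩
      acc X (lo + n) k leftRoot   ≈⟨ ih lo A n n≤span i≤N ⟩
      sumFrom A lo (suc n)        ∎

    accumulates-inRight : ∀ m → m ≤ span k → rightStart + m ≤ N →
      acc B (rightStart + m) (suc k) root ≈ sumFrom A lo (suc (suc (span k) + m))
    accumulates-inRight m m≤span i≤N = begin
      acc B i (suc k) root
        ≡⟨ acc-node-right k lo B i (<⇒≢ (≤-<-trans i≤rightRoot rightRoot<root)) leftRoot<i ⟩
      B leftRoot ∙ acc B i k rightRoot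
        ≡⟨ cong₂ _∙_ (buildT-node-left k lo A leftRoot ≤-refl) (acc-cong k rightStart B≡Y i) ⟩
      X leftRoot ∙ acc Y i k rightRoot
        ≈⟨ ∙-cong (buildT-root-sum k lo A (<⇒≤ (<-≤-trans leftRoot<i i≤N))) (ih rightStart X m m≤span i≤N) ⟩
      sumFrom A lo (suc s) ∙ sumFrom X rightStart (suc m)
        ≡⟨ cong (sumFrom A lo (suc s) ∙_) (sumFrom-cong rightStart (suc m) λ j _ → buildT-left-fixes-right k lo A j) ⟩
      sumFrom A lo (suc s) ∙ sumFrom A rightStart (suc m)
        ≈⟨ sumFrom-+ A lo (suc s) (suc m) ⟨
      sumFrom A lo (suc s + suc m)
        ≡⟨ cong (sumFrom A lo) (+-suc (suc s) m) ⟩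
      sumFrom A lo (suc (suc s + m))
        ∎
      where
      s = span k
      i = rightStart + m
      i≤rightRoot : i ≤ rightRoot
      i≤rightRoot = +-monoʳ-≤ rightStart m≤span
      leftRoot<i : leftRoot < i
      leftRoot<i = <-≤-trans leftRoot<rightStart (m≤m+n rightStart m)
      B≡Y : EqualOn rightStart rightRoot B Y
      B≡Y j _ j≤rightRoot = buildT-node-other k lo A j (<⇒≢ (≤-<-trans j≤rightRoot rightRoot<root))

  accumulatesPrefixSums : ∀ k → AccumulatesPrefixSums k
  accumulatesPrefixSums zero lo A zero z≤n i≤N =
    ≈-trans (reflexive (acc-self A zero (lo + 0))) (buildT-root-sum zero lo A i≤N)
  accumulatesPrefixSums (suc k) lo A n n≤span[1+k] i≤N with offset k n n≤span[1+k]
  ... | inLeft n≤span = accumulates-inLeft k lo A (accumulatesPrefixSums k) n n≤span i≤N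
  ... | inRight {m} m≤span =
    ≈-trans (reflexive (cong (λ i → acc B i (suc k) root) (sym (+-assoc lo (suc (span k)) m))))
      (accumulates-inRight k lo A (accumulatesPrefixSums k) m m≤span
        (subst (_≤ N) (sym (+-assoc lo (suc (span k)) m)) i≤N))
    where
    open Node k lo
    B = buildT (suc k) root A
  ... | atRoot =
    ≈-trans (reflexive (acc-self (buildT (suc k) root A) (suc k) root)) (buildT-root-sum (suc k) lo A i≤N)
    where open Node k lo

theorem1 : ∀ {c ℓ : Level} (G : Group c ℓ) (N : ℕ) → 1 ≤ N →
    (I : ℕ → Group.Carrier G) → (i : ℕ) → 1 ≤ i → i ≤ N →
    Group._≈_ G (SouthwestTree.accumulate G N (SouthwestTree.build G N I) i)
      (SouthwestTree.prefix G N I i)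
theorem1 G N _ I (suc n) _ 1+n≤N = begin
  acc (buildT L root I) (1 + n) L root
    ≡⟨ cong (λ r → acc (buildT L r I) (1 + n) L r) root≡1+span ⟩
  acc (buildT L (1 + span L) I) (1 + n) L (1 + span L)
    ≈⟨ accumulatesPrefixSums L 1 I n n≤span 1+n≤N ⟩
  sumFrom I 1 (suc n)
    ≈⟨ prefix≈sumFrom I n ⟨
  prefix I (suc n)
    ∎
  where
  open Group G using (setoid; monoid)
  open RangeSum monoid
  open SouthwestTree G N
  open SouthwestTreeProperties G N
  open SetoidReasoning setoid
  L = ⌊log₂ N ⌋
  root≡1+span : root ≡ 1 + span L
  root≡1+span = cong (_∸ 1) (2^[1+k]≡2+span L)
  n≤span : n ≤ span L
  n≤span = s≤s⁻¹ (≤-trans 1+n≤N (s≤s⁻¹ (subst (N <_) (2^[1+k]≡2+span L) (n<2^[1+⌊log₂n⌋] N))))
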